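{- Every right-residuated l-groupoid $\mathcal{G}=(L,\vee,\wedge,\odot,\rightarrow,0,1)$ is congruence permutable and $1$-regular. Moreover: (a) if $\mathcal{G}$ satisfies the double negation law, then it is $0$-regular; (b) if $\mathcal{G}$ satisfies divisibility and the double negation law, then it is congruence regular.
   Context: A right-residuated l-groupoid is an algebra $(L,\vee,\wedge,\odot,\rightarrow,0,1)$ of type $(2,2,2,2,0,0)$ such that $(L,\vee,\wedge)$ is a lattice with least element $0$ and greatest element $1$, $1\odot x=x$ for all $x$, and $x\odot y\le z$ iff $x\le y\rightarrow z$ for all $x,y,z$. Put $\rceil x:=x\rightarrow 0$; the double negation law is $\rceil\rceil x=x$ for all $x$; divisibility is $(x\rightarrow y)\odot x=x\wedge y$ for all $x,y$. An algebra is congruence permutable if $\varphi\circ\theta=\theta\circ\varphi$ for all congruences $\theta,\varphi$. For a constant $c$, an algebra is $c$-regular if for congruences $\theta,\varphi$, $\theta[c]=\varphi[c]$ implies $\theta=\varphi$ (where $\theta[a]$ denotes the congruence class of $a$). An algebra is congruence regular if for all congruences $\theta,\varphi$ and every element $a$, $\theta[a]=\varphi[a]$ implies $\theta=\varphi$. -}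

module Defs where

open import Level using (Level; _⊔_; suc)
open import Data.Product using (Σ; ∃; _×_; _,_)
open import Relation.Binary.PropositionalEquality using (_≡_)
open import Relation.Binary.Definitions using (Reflexive; Symmetric; Transitive)
open import Algebra.Lattice.Structures using (IsLattice)
open import Function.Bundles using (_⇔_)

record RRLGroupoid (a : Level) : Set (suc a) where
  infixr 6 _∨_
  infixr 7 _∧_
  infixl 8 _⊙_
  infixr 5 _⇒_
  infix 4 _≤_
  field
    L     : Set a
    _∨_   : L → L → L
    _∧_   : L → L → L
    _⊙_   : L → L → L
    _⇒_   : L → L → L
    𝟘     : L
    𝟙     : L
    isLattice : IsLattice _≡_ _∨_ _∧_

  _≤_ : L → L → Set a
  x ≤ y = x ∧ y ≡ x

  field
    𝟘-least    : ∀ x → 𝟘 ≤ x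
    𝟙-greatest : ∀ x → x ≤ 𝟙
    𝟙-identityˡ : ∀ x → 𝟙 ⊙ x ≡ x
    residuation : ∀ x y z → (x ⊙ y ≤ z) ⇔ (x ≤ (y ⇒ z))

  ¬′_ : L → L
  ¬′ x = x ⇒ 𝟘

module _ {a : Level} (G : RRLGroupoid a) where
  open RRLGroupoid G

  DoubleNegation : Set a
  DoubleNegation = ∀ x → ¬′ (¬′ x) ≡ x

  Divisibility : Set a
  Divisibility = ∀ x y → (x ⇒ y) ⊙ x ≡ x ∧ y

  record Congruence (ℓ : Level) : Set (a ⊔ suc ℓ) where
    field
      R     : L → L → Set ℓ
      refl  : Reflexive R
      sym   : Symmetric R
      trans : Transitive R
      ∨-cong : ∀ {x y u v} → R x y → R u v → R (x ∨ u) (y ∨ v)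
      ∧-cong : ∀ {x y u v} → R x y → R u v → R (x ∧ u) (y ∧ v)
      ⊙-cong : ∀ {x y u v} → R x y → R u v → R (x ⊙ u) (y ⊙ v)
      ⇒-cong : ∀ {x y u v} → R x y → R u v → R (x ⇒ u) (y ⇒ v)

  open Congruence using (R)

  _∘ᶜ_ : ∀ {ℓ} → Congruence ℓ → Congruence ℓ → L → L → Set (a ⊔ ℓ)
  (θ ∘ᶜ φ) x y = ∃ λ z → R θ x z × R φ z y

  _≐_ : ∀ {ℓ} → Congruence ℓ → Congruence ℓ → Set (a ⊔ ℓ)
  θ ≐ φ = ∀ x y → R θ x y ⇔ R φ x y

  SameClass : ∀ {ℓ} → Congruence ℓ → Congruence ℓ → L → Set (a ⊔ ℓ)
  SameClass θ φ c = ∀ x → R θ x c ⇔ R φ x c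

  CongruencePermutable : (ℓ : Level) → Set (a ⊔ suc ℓ)
  CongruencePermutable ℓ = (θ φ : Congruence ℓ) → ∀ x y → (φ ∘ᶜ θ) x y ⇔ (θ ∘ᶜ φ) x y

  Regular-at : (ℓ : Level) → L → Set (a ⊔ suc ℓ)
  Regular-at ℓ c = (θ φ : Congruence ℓ) → SameClass θ φ c → θ ≐ φ

  CongruenceRegular : (ℓ : Level) → Set (a ⊔ suc ℓ)
  CongruenceRegular ℓ = (θ φ : Congruence ℓ) → ∀ c → SameClass θ φ c → θ ≐ φ

-- The biresiduum x ⟺ y = (x ⇒ y) ∧ (y ⇒ x) gives the Mal'cev term
-- p x y z = ((x ⟺ y) ⊙ z) ∨ ((y ⟺ z) ⊙ x), whence permutability.  A congruence
-- relates x and y iff it relates both x ⇒ y and y ⇒ x to 1, so the class of 1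
-- determines the congruence.  Under double negation, x ↦ ¬′ x carries classes to
-- classes and ¬′ 0 = 1, so the class of 0 determines the class of 1.  With
-- divisibility, the class of 0 is recovered from that of any c:  if u ~ 0 then
-- u = u ∧ (u ∨ c) ~ u ∧ c = (c ⇒ u) ⊙ c ~ ¬′ c ⊙ c = 0, where c ⇒ u ~ ¬′ c lies in
-- the class of ¬′ c, itself determined by the class of c.
module Submission where

open import Defs
open import Level using (Level)
open import Data.Product using (_×_; _,_)
open import Function.Bundles using (mk⇔; Equivalence)
open import Relation.Binary.Bundles using (Setoid)
open import Relation.Binary.PropositionalEquality as ≡ using (_≡_; cong; cong₂; subst; subst₂)
open import Algebra.Lattice.Structures using (IsLattice)
open import Algebra.Lattice.Bundles using (Lattice)
import Algebra.Lattice.Properties.Lattice as LatticeProperties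
import Relation.Binary.Reasoning.Setoid as SetoidReasoning

module CongruenceClasses {a ℓ : Level} {G : RRLGroupoid a} where
  open RRLGroupoid G using (L)
  open Congruence using (R)

  sameClass-sym : (θ φ : Congruence G ℓ) {c : L} → SameClass G θ φ c → SameClass G φ θ c
  sameClass-sym θ φ θc≡φc x = mk⇔ (Equivalence.from (θc≡φc x)) (Equivalence.to (θc≡φc x))

  sameClass-transfer : {c d : L} →
    ((θ φ : Congruence G ℓ) → SameClass G θ φ c → ∀ x → R θ x d → R φ x d) →
    (θ φ : Congruence G ℓ) → SameClass G θ φ c → SameClass G θ φ d
  sameClass-transfer transfer θ φ θc≡φc x =
    mk⇔ (transfer θ φ θc≡φc x) (transfer φ θ (sameClass-sym θ φ θc≡φc) x)

  regular-at-by-inclusion : {c : L} →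
    ((θ φ : Congruence G ℓ) → SameClass G θ φ c → ∀ {x y} → R θ x y → R φ x y) →
    Regular-at G ℓ c
  regular-at-by-inclusion include θ φ θc≡φc x y =
    mk⇔ (include θ φ θc≡φc) (include φ θ (sameClass-sym θ φ θc≡φc))

module Properties {a : Level} (G : RRLGroupoid a) where
  open RRLGroupoid G
  open IsLattice isLattice using (∨-comm; ∧-comm; ∧-assoc; ∨-absorbs-∧)

  lattice : Lattice a a
  lattice = record { isLattice = isLattice }

  open LatticeProperties lattice using (∧-idem)
  open ≡.≡-Reasoning

  ≤-refl : ∀ x → x ≤ x
  ≤-refl = ∧-idem

  x∧y≤x : ∀ x y → x ∧ y ≤ x
  x∧y≤x x y = begin
    (x ∧ y) ∧ x  ≡⟨ ∧-assoc x y x ⟩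
    x ∧ (y ∧ x)  ≡⟨ cong (x ∧_) (∧-comm y x) ⟩
    x ∧ (x ∧ y)  ≡⟨ ∧-assoc x x y ⟨
    (x ∧ x) ∧ y  ≡⟨ cong (_∧ y) (∧-idem x) ⟩
    x ∧ y        ∎

  x∧y≤y : ∀ x y → x ∧ y ≤ y
  x∧y≤y x y = ≡.trans (∧-assoc x y y) (cong (x ∧_) (∧-idem y))

  ≤⇒∨≡ : ∀ {x y} → y ≤ x → x ∨ y ≡ x
  ≤⇒∨≡ {x} {y} y≤x = begin
    x ∨ y        ≡⟨ cong (x ∨_) y≤x ⟨
    x ∨ (y ∧ x)  ≡⟨ cong (x ∨_) (∧-comm y x) ⟩
    x ∨ (x ∧ y)  ≡⟨ ∨-absorbs-∧ x y ⟩
    x            ∎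

  𝟙≤⇒≡𝟙 : ∀ {x} → 𝟙 ≤ x → x ≡ 𝟙
  𝟙≤⇒≡𝟙 {x} 𝟙≤x = ≡.trans (≡.sym (𝟙-greatest x)) (≡.trans (∧-comm x 𝟙) 𝟙≤x)

  ≤𝟘⇒≡𝟘 : ∀ {x} → x ≤ 𝟘 → x ≡ 𝟘
  ≤𝟘⇒≡𝟘 {x} x≤𝟘 = ≡.trans (≡.sym x≤𝟘) (≡.trans (∧-comm x 𝟘) (𝟘-least x))

  uncurry-≤ : ∀ {t x y} → t ≤ x ⇒ y → t ⊙ x ≤ y
  uncurry-≤ {t} {x} {y} = Equivalence.from (residuation t x y)

  ⇒-diag : ∀ x → x ⇒ x ≡ 𝟙
  ⇒-diag x = 𝟙≤⇒≡𝟙 (Equivalence.to (residuation 𝟙 x x)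
    (subst (_≤ x) (≡.sym (𝟙-identityˡ x)) (≤-refl x)))

  𝟘∨x≡x : ∀ x → 𝟘 ∨ x ≡ x
  𝟘∨x≡x x = ≡.trans (∨-comm 𝟘 x) (≤⇒∨≡ (𝟘-least x))

  ¬′𝟘≡𝟙 : ¬′ 𝟘 ≡ 𝟙
  ¬′𝟘≡𝟙 = ⇒-diag 𝟘

  ¬′x⊙x≡𝟘 : ∀ x → ¬′ x ⊙ x ≡ 𝟘
  ¬′x⊙x≡𝟘 x = ≤𝟘⇒≡𝟘 (uncurry-≤ (≤-refl (¬′ x)))

  infixr 5 _⟺_
  _⟺_ : L → L → L
  x ⟺ y = (x ⇒ y) ∧ (y ⇒ x)

  ⟺-diag : ∀ x → x ⟺ x ≡ 𝟙
  ⟺-diag x = ≡.trans (cong₂ _∧_ (⇒-diag x) (⇒-diag x)) (∧-idem 𝟙)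

  malcev : L → L → L → L
  malcev x y z = ((x ⟺ y) ⊙ z) ∨ ((y ⟺ z) ⊙ x)

  malcev-xxz : ∀ x z → malcev x x z ≡ z
  malcev-xxz x z = begin
    ((x ⟺ x) ⊙ z) ∨ ((x ⟺ z) ⊙ x)  ≡⟨ cong (λ w → (w ⊙ z) ∨ ((x ⟺ z) ⊙ x)) (⟺-diag x) ⟩
    (𝟙 ⊙ z) ∨ ((x ⟺ z) ⊙ x)        ≡⟨ cong (_∨ ((x ⟺ z) ⊙ x)) (𝟙-identityˡ z) ⟩
    z ∨ ((x ⟺ z) ⊙ x)              ≡⟨ ≤⇒∨≡ (uncurry-≤ (x∧y≤x (x ⇒ z) (z ⇒ x))) ⟩
    z                              ∎

  malcev-xzz : ∀ x z → malcev x z z ≡ x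
  malcev-xzz x z = begin
    ((x ⟺ z) ⊙ z) ∨ ((z ⟺ z) ⊙ x)  ≡⟨ cong (λ w → ((x ⟺ z) ⊙ z) ∨ (w ⊙ x)) (⟺-diag z) ⟩
    ((x ⟺ z) ⊙ z) ∨ (𝟙 ⊙ x)        ≡⟨ cong (((x ⟺ z) ⊙ z) ∨_) (𝟙-identityˡ x) ⟩
    ((x ⟺ z) ⊙ z) ∨ x              ≡⟨ ∨-comm _ x ⟩
    x ∨ ((x ⟺ z) ⊙ z)              ≡⟨ ≤⇒∨≡ (uncurry-≤ (x∧y≤y (x ⇒ z) (z ⇒ x))) ⟩
    x                              ∎

module CongruenceProperties {a ℓ : Level} {G : RRLGroupoid a} (C : Congruence G ℓ) where
  open RRLGroupoid G
  open IsLattice isLattice using (∧-comm)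
  open Properties G
  open Congruence C

  setoid : Setoid a ℓ
  setoid = record
    { Carrier       = L
    ; _≈_           = R
    ; isEquivalence = record { refl = refl ; sym = sym ; trans = trans }
    }

  open SetoidReasoning setoid

  ⟺-cong : ∀ {x y u v} → R x y → R u v → R (x ⟺ u) (y ⟺ v)
  ⟺-cong x~y u~v = ∧-cong (⇒-cong x~y u~v) (⇒-cong u~v x~y)

  malcev-cong : ∀ {x x′ y y′ z z′} → R x x′ → R y y′ → R z z′ →
                R (malcev x y z) (malcev x′ y′ z′)
  malcev-cong x~ y~ z~ = ∨-cong (⊙-cong (⟺-cong x~ y~) z~) (⊙-cong (⟺-cong y~ z~) x~)

  ¬′-cong : ∀ {x y} → R x y → R (¬′ x) (¬′ y)
  ¬′-cong x~y = ⇒-cong x~y refl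

  ~⇒residual~𝟙 : ∀ {x y} → R x y → R (x ⇒ y) 𝟙
  ~⇒residual~𝟙 {x} {y} x~y = begin
    x ⇒ y  ≈⟨ ⇒-cong x~y refl ⟩
    y ⇒ y  ≡⟨ ⇒-diag y ⟩
    𝟙      ∎

  residual~𝟙⇒~∧ : ∀ {x y} → R (x ⇒ y) 𝟙 → R x (x ∧ y)
  residual~𝟙⇒~∧ {x} {y} x⇒y~𝟙 = begin
    x                    ≡⟨ 𝟙-identityˡ x ⟨
    𝟙 ⊙ x                ≈⟨ ⊙-cong x⇒y~𝟙 refl ⟨
    (x ⇒ y) ⊙ x          ≡⟨ uncurry-≤ (≤-refl (x ⇒ y)) ⟨
    (x ⇒ y) ⊙ x ∧ y      ≈⟨ ∧-cong (⊙-cong x⇒y~𝟙 refl) refl ⟩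
    𝟙 ⊙ x ∧ y            ≡⟨ cong (_∧ y) (𝟙-identityˡ x) ⟩
    x ∧ y                ∎

  residuals~𝟙⇒~ : ∀ {x y} → R (x ⇒ y) 𝟙 → R (y ⇒ x) 𝟙 → R x y
  residuals~𝟙⇒~ {x} {y} x⇒y~𝟙 y⇒x~𝟙 = begin
    x      ≈⟨ residual~𝟙⇒~∧ x⇒y~𝟙 ⟩
    x ∧ y  ≡⟨ ∧-comm x y ⟩
    y ∧ x  ≈⟨ residual~𝟙⇒~∧ y⇒x~𝟙 ⟨
    y      ∎

module Theorems {a ℓ : Level} (G : RRLGroupoid a) where
  open RRLGroupoid G
  open IsLattice isLattice using (∧-comm; ∧-absorbs-∨)
  open Properties G
  open CongruenceProperties
  open Congruence using (R)
  open CongruenceClasses {ℓ = ℓ} {G = G}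

  malcev-permutes : (θ φ : Congruence G ℓ) → ∀ {x y} → (_∘ᶜ_ G φ θ) x y → (_∘ᶜ_ G θ φ) x y
  malcev-permutes θ φ {x} {y} (z , x~φz , z~θy) =
      malcev x z y
    , subst (λ w → R θ w (malcev x z y)) (malcev-xzz x y)
        (malcev-cong θ (Congruence.refl θ) (Congruence.sym θ z~θy) (Congruence.refl θ))
    , subst (R φ (malcev x z y)) (malcev-xxz z y)
        (malcev-cong φ x~φz (Congruence.refl φ) (Congruence.refl φ))

  permutable : CongruencePermutable G ℓ
  permutable θ φ x y = mk⇔ (malcev-permutes θ φ) (malcev-permutes φ θ)

  regular-at-𝟙 : Regular-at G ℓ 𝟙
  regular-at-𝟙 = regular-at-by-inclusion λ θ φ θ𝟙≡φ𝟙 x~y →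
    residuals~𝟙⇒~ φ (Equivalence.to (θ𝟙≡φ𝟙 _) (~⇒residual~𝟙 θ x~y))
                    (Equivalence.to (θ𝟙≡φ𝟙 _) (~⇒residual~𝟙 θ (Congruence.sym θ x~y)))

  module _ (dn : DoubleNegation G) where

    ¬′-reflects : (C : Congruence G ℓ) → ∀ {x y} → R C (¬′ x) (¬′ y) → R C x y
    ¬′-reflects C {x} {y} ¬x~¬y = subst₂ (R C) (dn x) (dn y) (¬′-cong C ¬x~¬y)

    sameClass-¬′ : (θ φ : Congruence G ℓ) → ∀ {c} → SameClass G θ φ c → SameClass G θ φ (¬′ c)
    sameClass-¬′ θ φ {c} = sameClass-transfer include θ φ
      where
      include : (θ φ : Congruence G ℓ) → SameClass G θ φ c → ∀ x → R θ x (¬′ c) → R φ x (¬′ c)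
      include θ φ θc≡φc x x~¬c = ¬′-reflects φ
        (subst (R φ (¬′ x)) (≡.sym (dn c))
          (Equivalence.to (θc≡φc (¬′ x)) (subst (R θ (¬′ x)) (dn c) (¬′-cong θ x~¬c))))

    regular-at-𝟘 : Regular-at G ℓ 𝟘
    regular-at-𝟘 θ φ θ𝟘≡φ𝟘 =
      regular-at-𝟙 θ φ (subst (SameClass G θ φ) ¬′𝟘≡𝟙 (sameClass-¬′ θ φ θ𝟘≡φ𝟘))

    module _ (div : Divisibility G) where

      sameClass-𝟘 : (θ φ : Congruence G ℓ) → ∀ {c} → SameClass G θ φ c → SameClass G θ φ 𝟘
      sameClass-𝟘 θ φ {c} = sameClass-transfer include θ φ
        where
        include : (θ φ : Congruence G ℓ) → SameClass G θ φ c → ∀ u → R θ u 𝟘 → R φ u 𝟘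
        include θ φ θc≡φc u u~𝟘 = begin
          u                ≡⟨ ∧-absorbs-∨ u c ⟨
          u ∧ (u ∨ c)      ≈⟨ Congruence.∧-cong φ (Congruence.refl φ) u∨c~c ⟩
          u ∧ c            ≡⟨ ≡.trans (∧-comm u c) (≡.sym (div c u)) ⟩
          (c ⇒ u) ⊙ c      ≈⟨ Congruence.⊙-cong φ c⇒u~¬c (Congruence.refl φ) ⟩
          ¬′ c ⊙ c         ≡⟨ ¬′x⊙x≡𝟘 c ⟩
          𝟘                ∎
          where
          open SetoidReasoning (setoid φ)

          u∨c~c : R φ (u ∨ c) c
          u∨c~c = Equivalence.to (θc≡φc (u ∨ c))
            (subst (R θ (u ∨ c)) (𝟘∨x≡x c) (Congruence.∨-cong θ u~𝟘 (Congruence.refl θ)))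

          c⇒u~¬c : R φ (c ⇒ u) (¬′ c)
          c⇒u~¬c = Equivalence.to (sameClass-¬′ θ φ θc≡φc (c ⇒ u))
            (Congruence.⇒-cong θ (Congruence.refl θ) u~𝟘)

      congruenceRegular : CongruenceRegular G ℓ
      congruenceRegular θ φ c θc≡φc = regular-at-𝟘 θ φ (sameClass-𝟘 θ φ θc≡φc)

proposition6 : ∀ {a ℓ : Level} (G : RRLGroupoid a) →
    CongruencePermutable G ℓ
    × Regular-at G ℓ (RRLGroupoid.𝟙 G)
    × (DoubleNegation G → Regular-at G ℓ (RRLGroupoid.𝟘 G))
    × (Divisibility G → DoubleNegation G → CongruenceRegular G ℓ)
proposition6 {ℓ = ℓ} G =
  permutable , regular-at-𝟙 , regular-at-𝟘 , λ div dn → congruenceRegular dn div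
  where open Theorems {ℓ = ℓ} G
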